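{- Let $\ell$ be an odd prime and fix $\log_\ell$ as in the context. Any two Rado decorated graphs $(\Omega, f, g, \lambda)$ and $(\Omega', f', g', \lambda')$ are isomorphic, i.e. there is a bijection $\phi: \Omega \to \Omega'$ with $f'(\phi(v)) = f(v)$, $g'(\phi(x)) = g(x)$ and $\lambda'(\phi(v), \phi(w)) = \lambda(v,w)$ for all $v, w \in \Omega$ (for which these are defined) and $x \in \Omega_{\mathrm{fin}}$.
   Context: Fix an odd prime $\ell$ and an isomorphism of free rank-one $\mathbb{Z}_\ell$-modules $\log_\ell: 1 + \ell\mathbb{Z}_\ell \to \mathbb{Z}_\ell$; it maps $1 + \ell^{n+1}\mathbb{Z}_\ell$ onto $\ell^n\mathbb{Z}_\ell$, so $\log_\ell(1 + \ell\alpha) \bmod \ell^n$ depends only on $\alpha \bmod \ell^n$. Write $\mathbb{Z}/\ell^\infty\mathbb{Z} := \mathbb{Z}_\ell$. A decorated graph is a tuple $(\Omega, f, g, \lambda)$ where: $\Omega$ is a countably infinite set; $f: \Omega \to \mathbb{Z}_{\geq 1} \cup \{\infty\}$ has $f^{ -1}(\infty)$ of size exactly $2$, its elements denoted $v_\ell(1), v_\ell(2)$, and $\Omega_{\mathrm{fin}} := f^{ -1}(\mathbb{Z}_{\geq 1})$; $g$ assigns to each $v \in \Omega_{\mathrm{fin}}$ an element $g(v) \in (\mathbb{Z}/\ell^{f(v)}\mathbb{Z})^\ast$; $\lambda$ assigns to each ordered pair $(v,w)$ of distinct elements not both in $\{v_\ell(1), v_\ell(2)\}$ an element $\lambda(v,w)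 \in \mathbb{Z}/\ell^{f(v,w)}\mathbb{Z}$, where $f(v,w) := \min(f(v), f(w))$, such that $\lambda(v_\ell(1), w) \equiv \log_\ell(1 + g(w)\ell^{f(w)}) \bmod \ell^{f(w)}$ and $\lambda(w, v_\ell(i)) = 0$ for all $w \in \Omega_{\mathrm{fin}}$, $i \in \{1,2\}$. The decorated graph is Rado if for every finite $S \subseteq \Omega$ containing $\{v_\ell(1), v_\ell(2)\}$, every integer $n \geq 1$, every $\alpha \in (\mathbb{Z}/\ell^n\mathbb{Z})^\ast$ and all elements $\lambda_s(1), \lambda_s(2) \in \mathbb{Z}/\ell^{\min(n, f(s))}\mathbb{Z}$ ($s \in S$) with $\lambda_{v_\ell(1)}(2) \equiv \log_\ell(1 + \alpha\ell^n) \bmod \ell^n$ and $\lambda_{v_\ell(i)}(1) = 0$ for $i \in \{1,2\}$, there exists $v \in \Omega \setminus S$ with $f(v) = n$, $g(v) = \alpha$, and $\lambda(v,s) = \lambda_s(1)$, $\lambda(s,v) = \lambda_s(2)$ for all $s \in S$. -}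

module Defs where

open import Data.Nat using (ℕ; zero; suc; _+_; _*_; _∸_; _^_; _≤_; _<_; _⊓_)
open import Data.Nat.DivMod using (_%_)
open import Data.Nat.Coprimality using (Coprime)
open import Data.Product using (_×_; Σ; ∃; ∃-syntax)
open import Data.Sum using (_⊎_)
open import Data.List using (List)
open import Data.List.Membership.Propositional using (_∈_; _∉_)
open import Relation.Binary.PropositionalEquality using (_≡_; _≢_)
open import Function.Bundles using (_↔_; Inverse)

-- Reduction of a natural number modulo m (identity for m = 0; only ever
-- used with m = ℓ ^ n, ℓ prime, so the m = 0 case never matters).
modN : ℕ → ℕ → ℕ
modN a zero    = a
modN a (suc m) = a % suc m

_≡_[mod_] : ℕ → ℕ → ℕ → Set
a ≡ b [mod m ] = modN a m ≡ modN b m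

data ℕ∞ : Set where
  fin : ℕ → ℕ∞
  ∞   : ℕ∞

_⊓∞_ : ℕ∞ → ℕ∞ → ℕ∞
fin m ⊓∞ fin n = fin (m ⊓ n)
fin m ⊓∞ ∞     = fin m
∞     ⊓∞ y     = y

_⊓ℕ∞_ : ℕ → ℕ∞ → ℕ
n ⊓ℕ∞ fin m = n ⊓ m
n ⊓ℕ∞ ∞     = n

-- Elements of ℤ/ℓ^n are represented by canonical representatives in [0, ℓ^n);
-- units of ℤ/ℓ^n are the representatives coprime to ℓ^n.
IsUnitMod : ℕ → ℕ → ℕ → Set
IsUnitMod ℓ n x = x < ℓ ^ n × Coprime x (ℓ ^ n)

-- The ℓ-adic logarithm log_ℓ : 1 + ℓℤ_ℓ ≅ ℤ_ℓ (mapping 1 + ℓ^{n+1}ℤ_ℓ onto ℓ^nℤ_ℓ),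
-- encoded by its finite levels: L n a = log_ℓ(1 + ℓ a) mod ℓ^n.
-- A compatible family of group isomorphisms
--   ((1 + ℓℤ)/(1 + ℓ^{n+1}ℤ), ·)  ≅  (ℤ/ℓ^n, +)
-- is exactly the same datum as such an isomorphism of ℤ_ℓ-modules.
record IsLogℓ (ℓ : ℕ) (L : ℕ → ℕ → ℕ) : Set where
  field
    range   : ∀ n a → L n a < ℓ ^ n
    welldef : ∀ n a b → a ≡ b [mod ℓ ^ n ] → L n a ≡ L n b
    -- (1 + ℓa)(1 + ℓb) = 1 + ℓ(a + b + ℓab)
    hom     : ∀ n a b → L n (a + b + ℓ * a * b) ≡ modN (L n a + L n b) (ℓ ^ n)
    inj     : ∀ n a b → L n a ≡ L n b → a ≡ b [mod ℓ ^ n ]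
    compat  : ∀ m n a → m ≤ n → modN (L n a) (ℓ ^ m) ≡ L m a

-- log_ℓ(1 + α ℓ^n) mod ℓ^n   (n ≥ 1), i.e. L n (α ℓ^{n-1})
logTerm : ℕ → (ℕ → ℕ → ℕ) → ℕ → ℕ → ℕ
logTerm ℓ L n α = L n (α * ℓ ^ (n ∸ 1))

-- Decorated graphs.  g and Λ (= λ) are total functions; their values are
-- only constrained / meaningful where the paper defines them.
record DecoratedGraph (ℓ : ℕ) (L : ℕ → ℕ → ℕ) : Set₁ where
  field
    Ω          : Set
    countable  : Ω ↔ ℕ
    f          : Ω → ℕ∞
    f-pos      : ∀ v n → f v ≡ fin n → 1 ≤ n
    v₁ v₂      : Ω
    v₁≢v₂      : v₁ ≢ v₂
    f-v₁       : f v₁ ≡ ∞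
    f-v₂       : f v₂ ≡ ∞
    f-∞        : ∀ v → f v ≡ ∞ → v ≡ v₁ ⊎ v ≡ v₂
    g          : Ω → ℕ
    g-unit     : ∀ v n → f v ≡ fin n → IsUnitMod ℓ n (g v)
    Λ          : Ω → Ω → ℕ
    Λ-range    : ∀ v w → v ≢ w → ∀ m → f v ⊓∞ f w ≡ fin m → Λ v w < ℓ ^ m
    Λ-v₁       : ∀ w n → f w ≡ fin n → Λ v₁ w ≡ logTerm ℓ L n (g w)
    Λ-to-v₁    : ∀ w n → f w ≡ fin n → Λ w v₁ ≡ 0
    Λ-to-v₂    : ∀ w n → f w ≡ fin n → Λ w v₂ ≡ 0

module _ {ℓ : ℕ} {L : ℕ → ℕ → ℕ} where

  IsRado : DecoratedGraph ℓ L → Set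
  IsRado G =
    (S : List Ω) → v₁ ∈ S → v₂ ∈ S →
    (n : ℕ) → 1 ≤ n →
    (α : ℕ) → IsUnitMod ℓ n α →
    (l₁ l₂ : Ω → ℕ) →
    (∀ s → s ∈ S → l₁ s < ℓ ^ (n ⊓ℕ∞ f s)) →
    (∀ s → s ∈ S → l₂ s < ℓ ^ (n ⊓ℕ∞ f s)) →
    l₂ v₁ ≡ logTerm ℓ L n α →
    l₁ v₁ ≡ 0 → l₁ v₂ ≡ 0 →
    ∃[ v ] (v ∉ S × f v ≡ fin n × g v ≡ α ×
            (∀ s → s ∈ S → Λ v s ≡ l₁ s × Λ s v ≡ l₂ s))
    where open DecoratedGraph G

  Isomorphic : DecoratedGraph ℓ L → DecoratedGraph ℓ L → Set
  Isomorphic G G′ =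
    Σ (G.Ω ↔ G′.Ω) λ φ →
      let φ→ = Inverse.to φ in
      (∀ v → G′.f (φ→ v) ≡ G.f v) ×
      (∀ x n → G.f x ≡ fin n → G′.g (φ→ x) ≡ G.g x) ×
      (∀ v w → v ≢ w → ∀ m → G.f v ⊓∞ G.f w ≡ fin m →
         G′.Λ (φ→ v) (φ→ w) ≡ G.Λ v w)
    where
      module G  = DecoratedGraph G
      module G′ = DecoratedGraph G′

-- Back and forth: a finite partial isomorphism is a list of pairs preserving
-- f, g and λ and containing (v_ℓ(1), v'_ℓ(1)) and (v_ℓ(2), v'_ℓ(2)).  Any new
-- vertex a of Ω is finite, and the Rado property of Ω' applied to the image S
-- of the partial isomorphism, with prescribed values λ(a, ·) and λ(·, a)
-- transported along it, yields a fresh partner for a; symmetrically for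
-- vertices of Ω'.  Enumerating both countable sets and alternating the two
-- steps gives an increasing chain of partial isomorphisms whose union is the
-- required bijection.  Neither the primality of ℓ nor the properties of log_ℓ
-- enter the argument.
module Submission where

open import Defs
open import Data.Nat using (ℕ; zero; suc; _⊔_; _^_; _<_; _≤′_; ≤′-refl; ≤′-step)
open import Data.Nat.Properties using (⊓-comm; m≤m⊔n; m≤n⊔m; ≤⇒≤′; eq?)
open import Data.Nat.DivMod using (_%_)
open import Data.Nat.Primality using (Prime)
open import Data.Product using (_×_; Σ-syntax; ∃; ∃-syntax; _,_; proj₁; proj₂; swap)
open import Data.Sum using (inj₁; inj₂)
open import Data.List using (List; []; _∷_; map)
open import Data.List.Relation.Unary.Any using (here; there)
open import Data.List.Relation.Binary.Subset.Propositional using (_⊆_)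
open import Data.List.Membership.Propositional using (_∈_; _∉_)
open import Data.List.Membership.Propositional.Properties using (∈-map⁺; ∈-map⁻)
import Data.List.Membership.DecPropositional as DecMembership
open import Function using (id; _∘_)
open import Function.Bundles using (_↔_; Inverse; mk↔ₛ′)
open import Function.Properties.Inverse using (↔⇒↣)
open import Relation.Nullary using (yes; no; contradiction)
open import Relation.Binary.Definitions using (DecidableEquality)
open import Relation.Binary.PropositionalEquality
  using (_≡_; _≢_; refl; sym; trans; cong; cong₂; subst)

module _ {A B : Set} where

  dom : List (A × B) → List A
  dom = map proj₁

  ran : List (A × B) → List B
  ran = map proj₂

  ∈-dom⁻ : ∀ {P : List (A × B)} {x} → x ∈ dom P → ∃[ y ] (x , y) ∈ P
  ∈-dom⁻ x∈ with ∈-map⁻ proj₁ x∈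
  ... | _ , xy∈ , refl = _ , xy∈

  Functional : List (A × B) → Set
  Functional P = ∀ {x y y′} → (x , y) ∈ P → (x , y′) ∈ P → y ≡ y′

  Injective : List (A × B) → Set
  Injective P = ∀ {x x′ y} → (x , y) ∈ P → (x′ , y) ∈ P → x ≡ x′

  ∈-swap⁺ : ∀ {P : List (A × B)} {x y} → (x , y) ∈ P → (y , x) ∈ map swap P
  ∈-swap⁺ = ∈-map⁺ swap

  ∈-swap⁻ : ∀ {P : List (A × B)} {x y} → (y , x) ∈ map swap P → (x , y) ∈ P
  ∈-swap⁻ yx∈ with ∈-map⁻ swap yx∈
  ... | _ , xy∈P , refl = xy∈P

  module _ (_≟_ : DecidableEquality B) where

    preimageOr : A → List (A × B) → B → A
    preimageOr d [] y = d
    preimageOr d ((x , y′) ∷ P) y with y′ ≟ y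
    ... | yes _ = x
    ... | no _  = preimageOr d P y

    preimageOr-∈ : ∀ {d P x y} → Injective P → (x , y) ∈ P → preimageOr d P y ≡ x
    preimageOr-∈ {P = (x′ , y′) ∷ P} {y = y} inj xy∈ with y′ ≟ y
    ... | yes refl = inj (here refl) xy∈
    preimageOr-∈ inj (here refl)  | no y≢y = contradiction refl y≢y
    preimageOr-∈ inj (there xy∈) | no _   = preimageOr-∈ (λ m m′ → inj (there m) (there m′)) xy∈

module BackAndForth {A B : Set} (A↔ℕ : A ↔ ℕ) (B↔ℕ : B ↔ ℕ)
  (Good : List (A × B) → Set)
  (functional : ∀ {P} → Good P → Functional P)
  (injective : ∀ {P} → Good P → Injective P)
  (forth : ∀ {P} → Good P → ∀ a → ∃[ Q ] Good Q × P ⊆ Q × ∃[ b ] (a , b) ∈ Q)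
  (back : ∀ {P} → Good P → ∀ b → ∃[ Q ] Good Q × P ⊆ Q × ∃[ a ] (a , b) ∈ Q)
  (start : ∃ Good)
  where

  module A↔ℕ = Inverse A↔ℕ
  module B↔ℕ = Inverse B↔ℕ

  record Extension (P : List (A × B)) (a : A) (b : B) : Set where
    field
      pairs    : List (A × B)
      good     : Good pairs
      extends  : P ⊆ pairs
      image    : ∃[ b′ ] (a , b′) ∈ pairs
      preimage : ∃[ a′ ] (a′ , b) ∈ pairs

  extension : ∀ {P} → Good P → ∀ a b → Extension P a b
  extension gP a b =
    let Q , gQ , P⊆Q , b′ , ab′∈Q = forth gP a
        R , gR , Q⊆R , a′ , a′b∈R = back gQ b
    in record { pairs = R ; good = gR ; extends = Q⊆R ∘ P⊆Q
              ; image = b′ , Q⊆R ab′∈Q ; preimage = a′ , a′b∈R }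

  stage : ℕ → ∃ Good
  stage-extension : ∀ k → Extension (proj₁ (stage k)) (A↔ℕ.from k) (B↔ℕ.from k)

  stage zero    = start
  stage (suc k) = Extension.pairs (stage-extension k) , Extension.good (stage-extension k)

  stage-extension k = extension (proj₂ (stage k)) (A↔ℕ.from k) (B↔ℕ.from k)

  stagePairs : ℕ → List (A × B)
  stagePairs k = proj₁ (stage k)

  stagePairs-mono : ∀ {k j} → k ≤′ j → stagePairs k ⊆ stagePairs j
  stagePairs-mono ≤′-refl         = id
  stagePairs-mono (≤′-step k≤′j) = Extension.extends (stage-extension _) ∘ stagePairs-mono k≤′j

  stagePairs-⊔ : ∀ {i j p q} → p ∈ stagePairs i → q ∈ stagePairs j → p ∈ stagePairs (i ⊔ j) × q ∈ stagePairs (i ⊔ j)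
  stagePairs-⊔ {i} {j} p∈ q∈ = stagePairs-mono (≤⇒≤′ (m≤m⊔n i j)) p∈ , stagePairs-mono (≤⇒≤′ (m≤n⊔m i j)) q∈

  image-at : ∀ a → ∃[ b ] (a , b) ∈ stagePairs (suc (A↔ℕ.to a))
  image-at a = subst (λ x → ∃[ b ] (x , b) ∈ stagePairs (suc (A↔ℕ.to a))) (A↔ℕ.strictlyInverseʳ a)
                 (Extension.image (stage-extension (A↔ℕ.to a)))

  preimage-at : ∀ b → ∃[ a ] (a , b) ∈ stagePairs (suc (B↔ℕ.to b))
  preimage-at b = subst (λ y → ∃[ a ] (a , y) ∈ stagePairs (suc (B↔ℕ.to b))) (B↔ℕ.strictlyInverseʳ b)
                    (Extension.preimage (stage-extension (B↔ℕ.to b)))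

  φ : A → B
  φ a = proj₁ (image-at a)

  ψ : B → A
  ψ b = proj₁ (preimage-at b)

  φ∘ψ : ∀ b → φ (ψ b) ≡ b
  φ∘ψ b = let p∈ , q∈ = stagePairs-⊔ (proj₂ (image-at (ψ b))) (proj₂ (preimage-at b))
          in functional (proj₂ (stage _)) p∈ q∈

  ψ∘φ : ∀ a → ψ (φ a) ≡ a
  ψ∘φ a = let p∈ , q∈ = stagePairs-⊔ (proj₂ (preimage-at (φ a))) (proj₂ (image-at a))
          in injective (proj₂ (stage _)) p∈ q∈

  backAndForth : Σ[ φ ∈ A ↔ B ] ∀ v w →
    ∃[ P ] Good P × (v , Inverse.to φ v) ∈ P × (w , Inverse.to φ w) ∈ P
  backAndForth = mk↔ₛ′ φ ψ φ∘ψ ψ∘φ , λ v w →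
    let v∈ , w∈ = stagePairs-⊔ (proj₂ (image-at v)) (proj₂ (image-at w))
    in _ , proj₂ (stage _) , v∈ , w∈

fin⊓∞ : ∀ n z → fin n ⊓∞ z ≡ fin (n ⊓ℕ∞ z)
fin⊓∞ n (fin m) = refl
fin⊓∞ n ∞       = refl

⊓∞fin : ∀ n z → z ⊓∞ fin n ≡ fin (n ⊓ℕ∞ z)
⊓∞fin n (fin m) = cong fin (⊓-comm m n)
⊓∞fin n ∞       = refl

module _ {ℓ : ℕ} {L : ℕ → ℕ → ℕ} (G : DecoratedGraph ℓ L) where
  open DecoratedGraph G

  Λ-rangeˡ : ∀ {v w n} → v ≢ w → f v ≡ fin n → Λ v w < ℓ ^ (n ⊓ℕ∞ f w)
  Λ-rangeˡ {v} {w} {n} v≢w fv≡n = Λ-range v w v≢w _ (trans (cong (_⊓∞ f w) fv≡n) (fin⊓∞ n (f w)))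

  Λ-rangeʳ : ∀ {v w n} → v ≢ w → f w ≡ fin n → Λ v w < ℓ ^ (n ⊓ℕ∞ f v)
  Λ-rangeʳ {v} {w} {n} v≢w fw≡n = Λ-range v w v≢w _ (trans (cong (f v ⊓∞_) fw≡n) (⊓∞fin n (f v)))

  _≟Ω_ : DecidableEquality Ω
  _≟Ω_ = eq? (↔⇒↣ countable)

module _ {ℓ : ℕ} {L : ℕ → ℕ → ℕ} (G G′ : DecoratedGraph ℓ L) where
  private
    module A = DecoratedGraph G
    module B = DecoratedGraph G′

  record PartialIso (P : List (A.Ω × B.Ω)) : Set where
    field
      ∈-v₁       : (A.v₁ , B.v₁) ∈ P
      ∈-v₂       : (A.v₂ , B.v₂) ∈ P
      functional : Functional P
      injective  : Injective P
      f-pres     : ∀ {a b} → (a , b) ∈ P → B.f b ≡ A.f a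
      g-pres     : ∀ {a b} → (a , b) ∈ P → ∀ n → A.f a ≡ fin n → B.g b ≡ A.g a
      Λ-pres     : ∀ {a b c d} → (a , b) ∈ P → (c , d) ∈ P → a ≢ c →
                   ∀ m → A.f a ⊓∞ A.f c ≡ fin m → B.Λ b d ≡ A.Λ a c

  partialIso-v₁v₂ : PartialIso ((A.v₁ , B.v₁) ∷ (A.v₂ , B.v₂) ∷ [])
  partialIso-v₁v₂ = record
    { ∈-v₁ = here refl ; ∈-v₂ = there (here refl)
    ; functional = functional ; injective = injective
    ; f-pres = λ ab∈ → trans (proj₂ (infinite ab∈)) (sym (proj₁ (infinite ab∈)))
    ; g-pres = λ ab∈ n fa≡n → contradiction (trans (sym fa≡n) (proj₁ (infinite ab∈))) λ ()
    ; Λ-pres = λ ab∈ cd∈ _ m e →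
        contradiction (trans (sym e) (cong₂ _⊓∞_ (proj₁ (infinite ab∈)) (proj₁ (infinite cd∈)))) λ ()
    }
    where
      P₀ : List (A.Ω × B.Ω)
      P₀ = (A.v₁ , B.v₁) ∷ (A.v₂ , B.v₂) ∷ []

      infinite : ∀ {a b} → (a , b) ∈ P₀ → A.f a ≡ ∞ × B.f b ≡ ∞
      infinite (here refl)         = A.f-v₁ , B.f-v₁
      infinite (there (here refl)) = A.f-v₂ , B.f-v₂

      functional : Functional P₀
      functional (here refl)         (here refl)         = refl
      functional (here refl)         (there (here e))    = contradiction (cong proj₁ e) A.v₁≢v₂
      functional (there (here refl)) (here e)            = contradiction (sym (cong proj₁ e)) A.v₁≢v₂
      functional (there (here refl)) (there (here refl)) = refl

      injective : Injective P₀
      injective (here refl)         (here refl)         = refl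
      injective (here refl)         (there (here e))    = contradiction (cong proj₂ e) B.v₁≢v₂
      injective (there (here refl)) (here e)            = contradiction (sym (cong proj₂ e)) B.v₁≢v₂
      injective (there (here refl)) (there (here refl)) = refl

  module _ {P : List (A.Ω × B.Ω)} (isoP : PartialIso P) where
    open PartialIso isoP
    open DecMembership (_≟Ω_ G) using (_∈?_)

    infinite-∈dom : ∀ {a} → A.f a ≡ ∞ → a ∈ dom P
    infinite-∈dom {a} fa≡∞ with A.f-∞ a fa≡∞
    ... | inj₁ refl = ∈-map⁺ proj₁ ∈-v₁
    ... | inj₂ refl = ∈-map⁺ proj₁ ∈-v₂

    partialIso-∷ : ∀ {a b} → a ∉ dom P → b ∉ ran P → B.f b ≡ A.f a → B.g b ≡ A.g a →
      (∀ {x y} → (x , y) ∈ P → B.Λ b y ≡ A.Λ a x × B.Λ y b ≡ A.Λ x a) →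
      PartialIso ((a , b) ∷ P)
    partialIso-∷ {a} {b} a∉ b∉ fb≡fa gb≡ga Λ-agree = record
      { ∈-v₁ = there ∈-v₁ ; ∈-v₂ = there ∈-v₂
      ; functional = functional′ ; injective = injective′
      ; f-pres = λ { (here refl) → fb≡fa ; (there m) → f-pres m }
      ; g-pres = λ { (here refl) _ _ → gb≡ga ; (there m) → g-pres m }
      ; Λ-pres = Λ-pres′ }
      where
        functional′ : Functional ((a , b) ∷ P)
        functional′ (here refl) (here refl) = refl
        functional′ (here refl) (there m)   = contradiction (∈-map⁺ proj₁ m) a∉
        functional′ (there m)   (here refl) = contradiction (∈-map⁺ proj₁ m) a∉
        functional′ (there m)   (there m′)  = functional m m′

        injective′ : Injective ((a , b) ∷ P)
        injective′ (here refl) (here refl) = refl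
        injective′ (here refl) (there m)   = contradiction (∈-map⁺ proj₂ m) b∉
        injective′ (there m)   (here refl) = contradiction (∈-map⁺ proj₂ m) b∉
        injective′ (there m)   (there m′)  = injective m m′

        Λ-pres′ : ∀ {x y z w} → (x , y) ∈ (a , b) ∷ P → (z , w) ∈ (a , b) ∷ P → x ≢ z →
                  ∀ m → A.f x ⊓∞ A.f z ≡ fin m → B.Λ y w ≡ A.Λ x z
        Λ-pres′ (here refl) (here refl) a≢a = contradiction refl a≢a
        Λ-pres′ (here refl) (there m)   _ _ _ = proj₁ (Λ-agree m)
        Λ-pres′ (there m)   (here refl) _ _ _ = proj₂ (Λ-agree m)
        Λ-pres′ (there m)   (there m′)  = Λ-pres m m′

    rado-partner : IsRado G′ → ∀ {a n} → a ∉ dom P → A.f a ≡ fin n →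
      ∃[ b ] b ∉ ran P × B.f b ≡ fin n × B.g b ≡ A.g a ×
             (∀ {x y} → (x , y) ∈ P → B.Λ b y ≡ A.Λ a x × B.Λ y b ≡ A.Λ x a)
    rado-partner rado {a} {n} a∉ fa≡n =
      let b , b∉ , fb≡n , gb≡ga , Λb =
            rado (ran P) (∈-map⁺ proj₂ ∈-v₁) (∈-map⁺ proj₂ ∈-v₂) n (A.f-pos a n fa≡n)
                 (A.g a) (A.g-unit a n fa≡n) λ₁ λ₂ range₁ range₂ λ₂-v₁ λ₁-v₁ λ₁-v₂
      in b , b∉ , fb≡n , gb≡ga , Λ-agree Λb
      where
        back : B.Ω → A.Ω
        back = preimageOr (_≟Ω_ G′) a P

        back-∈ : ∀ {x y} → (x , y) ∈ P → back y ≡ x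
        back-∈ = preimageOr-∈ (_≟Ω_ G′) injective

        λ₁ λ₂ : B.Ω → ℕ
        λ₁ s = A.Λ a (back s)
        λ₂ s = A.Λ (back s) a

        a≢ : ∀ {x y} → (x , y) ∈ P → a ≢ x
        a≢ xy∈ refl = a∉ (∈-map⁺ proj₁ xy∈)

        range₁ : ∀ s → s ∈ ran P → λ₁ s < ℓ ^ (n ⊓ℕ∞ B.f s)
        range₁ _ s∈ with ∈-map⁻ proj₂ s∈
        ... | _ , xy∈ , refl rewrite back-∈ xy∈ | f-pres xy∈ = Λ-rangeˡ G (a≢ xy∈) fa≡n

        range₂ : ∀ s → s ∈ ran P → λ₂ s < ℓ ^ (n ⊓ℕ∞ B.f s)
        range₂ _ s∈ with ∈-map⁻ proj₂ s∈
        ... | _ , xy∈ , refl rewrite back-∈ xy∈ | f-pres xy∈ = Λ-rangeʳ G (a≢ xy∈ ∘ sym) fa≡n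

        λ₂-v₁ : λ₂ B.v₁ ≡ logTerm ℓ L n (A.g a)
        λ₂-v₁ = trans (cong (λ x → A.Λ x a) (back-∈ ∈-v₁)) (A.Λ-v₁ a n fa≡n)

        λ₁-v₁ : λ₁ B.v₁ ≡ 0
        λ₁-v₁ = trans (cong (A.Λ a) (back-∈ ∈-v₁)) (A.Λ-to-v₁ a n fa≡n)

        λ₁-v₂ : λ₁ B.v₂ ≡ 0
        λ₁-v₂ = trans (cong (A.Λ a) (back-∈ ∈-v₂)) (A.Λ-to-v₂ a n fa≡n)

        Λ-agree : ∀ {b} → (∀ s → s ∈ ran P → B.Λ b s ≡ λ₁ s × B.Λ s b ≡ λ₂ s) →
                  ∀ {x y} → (x , y) ∈ P → B.Λ b y ≡ A.Λ a x × B.Λ y b ≡ A.Λ x a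
        Λ-agree {b} Λb {y = y} xy∈ =
          subst (λ x → B.Λ b y ≡ A.Λ a x × B.Λ y b ≡ A.Λ x a) (back-∈ xy∈) (Λb y (∈-map⁺ proj₂ xy∈))

    partialIso-forth : IsRado G′ → ∀ a → ∃[ Q ] PartialIso Q × P ⊆ Q × ∃[ b ] (a , b) ∈ Q
    partialIso-forth rado a with a ∈? dom P
    ... | yes a∈ = let b , ab∈ = ∈-dom⁻ a∈ in P , isoP , id , b , ab∈
    ... | no a∉ with A.f a in fa≡
    ...   | ∞     = contradiction (infinite-∈dom fa≡) a∉
    ...   | fin n = let b , b∉ , fb≡n , gb≡ga , Λ-agree = rado-partner rado a∉ fa≡
                    in (a , b) ∷ P , partialIso-∷ a∉ b∉ (trans fb≡n (sym fa≡)) gb≡ga Λ-agree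
                     , there , b , here refl

module _ {ℓ : ℕ} {L : ℕ → ℕ → ℕ} {G G′ : DecoratedGraph ℓ L} where

  partialIso-swap : ∀ {P} → PartialIso G G′ P → PartialIso G′ G (map swap P)
  partialIso-swap isoP = record
    { ∈-v₁ = ∈-swap⁺ ∈-v₁ ; ∈-v₂ = ∈-swap⁺ ∈-v₂
    ; functional = λ m m′ → injective (∈-swap⁻ m) (∈-swap⁻ m′)
    ; injective = λ m m′ → functional (∈-swap⁻ m) (∈-swap⁻ m′)
    ; f-pres = λ m → sym (f-pres (∈-swap⁻ m))
    ; g-pres = λ m n fb≡n → sym (g-pres (∈-swap⁻ m) n (trans (sym (f-pres (∈-swap⁻ m))) fb≡n))
    ; Λ-pres = λ m m′ b≢d k e →
        sym (Λ-pres (∈-swap⁻ m) (∈-swap⁻ m′) (λ { refl → b≢d (functional (∈-swap⁻ m) (∈-swap⁻ m′)) }) k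
                    (trans (cong₂ _⊓∞_ (sym (f-pres (∈-swap⁻ m))) (sym (f-pres (∈-swap⁻ m′)))) e))
    }
    where open PartialIso isoP

module _ {ℓ : ℕ} {L : ℕ → ℕ → ℕ} (G G′ : DecoratedGraph ℓ L) where

  partialIso-back : IsRado G → ∀ {P} → PartialIso G G′ P →
    ∀ b → ∃[ Q ] PartialIso G G′ Q × P ⊆ Q × ∃[ a ] (a , b) ∈ Q
  partialIso-back rado isoP b =
    let Q , isoQ , swapP⊆Q , a , ba∈Q = partialIso-forth G′ G (partialIso-swap isoP) rado b
    in map swap Q , partialIso-swap isoQ , ∈-swap⁺ ∘ swapP⊆Q ∘ ∈-swap⁺ , a , ∈-swap⁺ ba∈Q

  rado-isomorphic : IsRado G → IsRado G′ → Isomorphic G G′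
  rado-isomorphic radoG radoG′ =
    let φ , shared = backAndForth in
    φ , (λ v → let _ , isoP , v∈ , _ = shared v v in PartialIso.f-pres isoP v∈)
      , (λ v → let _ , isoP , v∈ , _ = shared v v in PartialIso.g-pres isoP v∈)
      , (λ v w → let _ , isoP , v∈ , w∈ = shared v w in PartialIso.Λ-pres isoP v∈ w∈)
    where
      open BackAndForth (DecoratedGraph.countable G) (DecoratedGraph.countable G′)
             (PartialIso G G′) PartialIso.functional PartialIso.injective
             (λ isoP → partialIso-forth G G′ isoP radoG′) (partialIso-back radoG)
             (_ , partialIso-v₁v₂ G G′)
        using (backAndForth)

theorem2p6 : (ℓ : ℕ) → Prime ℓ → ℓ % 2 ≡ 1 →
    (L : ℕ → ℕ → ℕ) → IsLogℓ ℓ L →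
    (G G′ : DecoratedGraph ℓ L) → IsRado G → IsRado G′ →
    Isomorphic G G′
theorem2p6 _ _ _ _ _ = rado-isomorphic
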